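{- Let $Y$ be a graph and $\sigma=\{S_0,S_1,\dots,S_d\}$ a walk-equitable collection in $Y$. Then for any $i\neq j$, either $S_i\cap S_j=\emptyset$ or $S_i=S_j$.
   Context: A collection $\{S_0,\dots,S_d\}$ of subsets of $V(Y)$ is walk-equitable in $Y$ if for every non-negative integer $m$, every $i,j$ and every vertex $u\in S_i$, the number of walks of length $m$ in $Y$ from $u$ to (a vertex of) $S_j$ depends only on $i$ and $j$. ($Y$ need not be connected.) -}

module Defs where

open import Data.Nat using (ℕ; zero; suc; _+_)
open import Data.Bool using (Bool; true; false; if_then_else_)
open import Data.Fin using (Fin; zero; suc)
open import Data.Fin.Subset using (Subset; _∈_)
open import Data.Vec using (lookup)
open import Data.Product using (_×_)
open import Relation.Nullary using (¬_; does)
open import Relation.Binary.PropositionalEquality using (_≡_)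
import Data.Fin as F

record Graph (n : ℕ) : Set where
  field
    adj   : Fin n → Fin n → Bool
    sym   : ∀ u v → adj u v ≡ adj v u
    loopless : ∀ u → adj u u ≡ false
open Graph public

sumFin : (n : ℕ) → (Fin n → ℕ) → ℕ
sumFin zero    f = 0
sumFin (suc n) f = f zero + sumFin n (λ v → f (suc v))

walks : ∀ {n} → Graph n → ℕ → Fin n → Fin n → ℕ
walks Y zero    u v = if does (u F.≟ v) then 1 else 0
walks Y (suc m) u v = sumFin _ (λ w → if adj Y u w then walks Y m w v else 0)

walksTo : ∀ {n} → Graph n → ℕ → Fin n → Subset n → ℕ
walksTo Y m u S = sumFin _ (λ v → if lookup S v then walks Y m u v else 0)

WalkEquitable : ∀ {n d} → Graph n → (Fin (suc d) → Subset n) → Set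
WalkEquitable Y S =
  ∀ (m : ℕ) (i j : Fin _) (u v : Fin _) →
    u ∈ S i → v ∈ S i → walksTo Y m u (S j) ≡ walksTo Y m v (S j)

-- Only walks of length 0 matter: the number of such walks from u to S_j is 1 if
-- u ∈ S_j and 0 otherwise, so walk-equitability at m = 0 says that membership in
-- S_j is constant on S_i. A common vertex of S_i and S_j therefore forces
-- S_i ⊆ S_j, and symmetrically S_j ⊆ S_i.
module Submission where

open import Defs
open import Data.Nat using (ℕ; suc)
open import Data.Fin using (Fin)
open import Data.Fin.Subset using (Subset; _∈_)
open import Data.Product using (_×_)
open import Data.Sum using (_⊎_)
open import Relation.Nullary using (¬_)
open import Relation.Binary.PropositionalEquality using (_≡_)

open import Data.Nat using (_+_) renaming (zero to 0ℕ)
open import Data.Bool using (Bool; true; false; if_then_else_)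
open import Data.Bool.Properties using (if-eta)
open import Data.Nat.Properties using (+-identityʳ)
open import Data.Fin using (zero; suc; _≟_)
open import Data.Fin.Properties using (any?; suc-injective)
open import Data.Fin.Subset using (_⊆_)
open import Data.Fin.Subset.Properties using (⊆-antisym; _∈?_)
open import Data.Vec using (lookup)
open import Data.Vec.Properties using ([]=⇒lookup; lookup⇒[]=)
open import Data.Product using (_,_)
open import Data.Sum using (inj₁; inj₂)
open import Relation.Nullary using (yes; no)
open import Relation.Nullary.Decidable using (_×-dec_; dec-true; dec-false)
open import Relation.Binary.PropositionalEquality
  using (refl; cong; _≢_; module ≡-Reasoning) renaming (sym to ≡-sym)

indicator : Bool → ℕ
indicator b = if b then 1 else 0

indicator-injective : ∀ {b c} → indicator b ≡ indicator c → b ≡ c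
indicator-injective {true}  {true}  _ = refl
indicator-injective {false} {false} _ = refl

sumFin-zero : ∀ n (f : Fin n → ℕ) → (∀ v → f v ≡ 0) → sumFin n f ≡ 0
sumFin-zero 0ℕ      f f≡0 = refl
sumFin-zero (suc n) f f≡0 rewrite f≡0 zero = sumFin-zero n (λ v → f (suc v)) (λ v → f≡0 (suc v))

sumFin-supported-at : ∀ n (f : Fin n → ℕ) (u : Fin n) →
  (∀ v → v ≢ u → f v ≡ 0) → sumFin n f ≡ f u
sumFin-supported-at (suc n) f zero f≡0 = begin
  f zero + sumFin n (λ v → f (suc v)) ≡⟨ cong (f zero +_) (sumFin-zero n _ λ v → f≡0 (suc v) λ ()) ⟩
  f zero + 0                          ≡⟨ +-identityʳ (f zero) ⟩
  f zero                              ∎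
  where open ≡-Reasoning
sumFin-supported-at (suc n) f (suc u) f≡0 rewrite f≡0 zero λ () =
  sumFin-supported-at n (λ v → f (suc v)) u λ v v≢u → f≡0 (suc v) (λ sv≡su → v≢u (suc-injective sv≡su))

walksTo-length-zero : ∀ {n} (Y : Graph n) (u : Fin n) (S : Subset n) →
  walksTo Y 0 u S ≡ indicator (lookup S u)
walksTo-length-zero {n} Y u S = begin
  walksTo Y 0 u S                ≡⟨ sumFin-supported-at n _ u off-u ⟩
  walks0-into-S u                ≡⟨ cong (λ b → if lookup S u then indicator b else 0) (dec-true (u ≟ u) refl) ⟩
  indicator (lookup S u)         ∎
  where
  open ≡-Reasoning
  walks0-into-S : Fin n → ℕ
  walks0-into-S v = if lookup S v then walks Y 0 u v else 0
  off-u : ∀ v → v ≢ u → walks0-into-S v ≡ 0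
  off-u v v≢u rewrite dec-false (u ≟ v) (λ u≡v → v≢u (≡-sym u≡v)) = if-eta (lookup S v)

overlapping⇒⊆ : ∀ {n d} (Y : Graph n) (S : Fin (suc d) → Subset n) → WalkEquitable Y S →
  ∀ {i j x} → x ∈ S i → x ∈ S j → S i ⊆ S j
overlapping⇒⊆ Y S equitable {i} {j} {x} x∈Si x∈Sj {u} u∈Si =
  lookup⇒[]= u (S j) (indicator-injective (begin
    indicator (lookup (S j) u) ≡⟨ ≡-sym (walksTo-length-zero Y u (S j)) ⟩
    walksTo Y 0 u (S j)        ≡⟨ equitable 0 i j u x u∈Si x∈Si ⟩
    walksTo Y 0 x (S j)        ≡⟨ walksTo-length-zero Y x (S j) ⟩
    indicator (lookup (S j) x) ≡⟨ cong indicator ([]=⇒lookup x∈Sj) ⟩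
    indicator true             ∎))
  where open ≡-Reasoning

lemma5p1 : ∀ {n d} (Y : Graph n) (S : Fin (suc d) → Subset n) →
    WalkEquitable Y S → ∀ (i j : Fin (suc d)) → ¬ (i ≡ j) →
    (∀ (x : Fin n) → ¬ (x ∈ S i × x ∈ S j)) ⊎ (S i ≡ S j)
lemma5p1 Y S equitable i j _ with any? (λ x → (x ∈? S i) ×-dec (x ∈? S j))
... | no ¬common = inj₁ λ x x∈both → ¬common (x , x∈both)
... | yes (x , x∈Si , x∈Sj) =
  inj₂ (⊆-antisym (overlapping⇒⊆ Y S equitable x∈Si x∈Sj) (overlapping⇒⊆ Y S equitable x∈Sj x∈Si))
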